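{- Consider the generic push-relabel algorithm on a flow network with integer capacities in which the admissibility criterion is relaxed so that a residual arc $(u,v)$ is admissible whenever $d(u)>d(v)$. That is: initially $d(s)=n$, $d(u)=0$ for $u\neq s$, and every arc out of $s$ is saturated; then, while some vertex $u\notin\{s,t\}$ has excess $e(u)>0$, either push $\delta=\min\{e(u),r(u,v)\}$ units of flow along a residual arc $(u,v)$ with $d(u)>d(v)$, or, if no such arc exists, relabel $u$ by setting $d(u)=\min\{d(v): r(u,v)>0\}+1$. Then this algorithm terminates (for any order of choosing operations).
   Context: A flow network has vertex set $V$ with $|V|=n$, arc set $A$, source $s$, sink $t$ and integer capacities $c$. A preflow is $f:V\times V\to\mathbb{Z}_{\ge 0}$ with $f(u,v)\le c(u,v)$ and excess $e(u)=\sum_v f(v,u)-\sum_v f(u,v)\ge 0$ for all $u\in V\setminus\{s,t\}$. The residual capacity is $r(u,v)=c(u,v)-f(u,v)$ if $(u,v)\in A$, $r(u,v)=f(v,u)$ if $(v,u)\in A$, and $0$ otherwise; a residual arc is a pair with $r(u,v)>0$. Pushing $\delta$ units along $(u,v)$ increases the flow from $u$ to $v$ by $\delta$ (decreasing $r(u,v)$ and increasing $r(v,u)$ by $\delta$). $d:V\to\mathbb{Z}_{\ge0}$ is the distance labeling. -}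

module Defs where

open import Data.Nat using (ℕ; zero; suc; _+_; _∸_; _<_; _≤_; _⊔_; _⊓_)
open import Data.Fin using (Fin; _≟_)
open import Data.Bool using (Bool; true; false; if_then_else_; _∧_)
open import Data.Product using (_×_; Σ; ∃; _,_)
open import Relation.Binary.PropositionalEquality using (_≡_; _≢_)
open import Relation.Nullary using (¬_)
open import Relation.Nullary.Decidable using (⌊_⌋)

sumFin : ∀ {n} → (Fin n → ℕ) → ℕ
sumFin {zero}  g = 0
sumFin {suc n} g = g Fin.zero + sumFin (λ i → g (Fin.suc i))

-- Capacities are natural numbers; off the
-- arc set the capacity is 0.  The residual-capacity definition of the paper
-- is only well defined when A contains no pair of antiparallel arcs (and no
-- self-loops), which we assume.
record Network (n : ℕ) : Set where
  field
    s t        : Fin n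
    s≢t        : s ≢ t
    arc        : Fin n → Fin n → Bool
    cap        : Fin n → Fin n → ℕ
    cap-off    : ∀ u v → arc u v ≡ false → cap u v ≡ 0
    antipar    : ∀ u v → arc u v ≡ true → arc v u ≡ false

record State (n : ℕ) : Set where
  constructor ⟨_,_⟩
  field
    flow  : Fin n → Fin n → ℕ
    label : Fin n → ℕ

module _ {n : ℕ} (N : Network n) where
  open Network N

  inflow outflow : (Fin n → Fin n → ℕ) → Fin n → ℕ
  inflow  f u = sumFin (λ v → f v u)
  outflow f u = sumFin (λ v → f u v)

  -- e(u) > 0  ⇔  Σ_v f(v,u) > Σ_v f(u,v); when positive, e(u) = inflow ∸ outflow.
  excess : (Fin n → Fin n → ℕ) → Fin n → ℕ
  excess f u = inflow f u ∸ outflow f u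

  residual : (Fin n → Fin n → ℕ) → Fin n → Fin n → ℕ
  residual f u v =
    if arc u v then cap u v ∸ f u v
    else (if arc v u then f v u else 0)

  setFlow : (Fin n → Fin n → ℕ) → Fin n → Fin n → ℕ → (Fin n → Fin n → ℕ)
  setFlow f a b k x y = if ⌊ x ≟ a ⌋ ∧ ⌊ y ≟ b ⌋ then k else f x y

  pushFlow : (Fin n → Fin n → ℕ) → Fin n → Fin n → ℕ → (Fin n → Fin n → ℕ)
  pushFlow f u v δ =
    if arc u v then setFlow f u v (f u v + δ)
    else setFlow f v u (f v u ∸ δ)

  setLabel : (Fin n → ℕ) → Fin n → ℕ → (Fin n → ℕ)
  setLabel d a k x = if ⌊ x ≟ a ⌋ then k else d x

  initState : State n
  initState = ⟨ (λ x y → if ⌊ x ≟ s ⌋ ∧ arc x y then cap x y else 0)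
              , (λ x → if ⌊ x ≟ s ⌋ then n else 0) ⟩

  Active : (Fin n → Fin n → ℕ) → Fin n → Set
  Active f u = u ≢ s × u ≢ t × outflow f u < inflow f u

  data Step : State n → State n → Set where
    push : ∀ {f d} u v →
           Active f u →
           0 < residual f u v →
           d v < d u →
           Step ⟨ f , d ⟩
                ⟨ pushFlow f u v (excess f u ⊓ residual f u v) , d ⟩
    relabel : ∀ {f d} u m →
           Active f u →
           (∀ v → 0 < residual f u v → ¬ (d v < d u)) →
           (∃ λ v → 0 < residual f u v × d v ≡ m) →
           (∀ v → 0 < residual f u v → m ≤ d v) →
           Step ⟨ f , d ⟩ ⟨ f , setLabel d u (suc m) ⟩

-- The algorithm terminates because the pair (Σ (2n − d), Φ) decreases
-- lexicographically at every step.
--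
-- Relabelling raises a label strictly, and the label of an active vertex u
-- stays below 2n.  Labels are valid (d x ≤ d y + 1 on residual arcs) with
-- d s = n.  If a level g > n were occupied by no vertex, the set {x : d x > g}
-- would be closed under residual arcs, so no flow would enter it, and a set
-- avoiding s into which no flow enters cannot contain a vertex of positive
-- excess.  Hence all levels n, …, d u are occupied, by distinct vertices, so
-- d u < 2n.
--
-- Pushes leave the labels fixed and decrease
-- Φ = Σ over pairs (x,y) of f(x,y)·d(y) + (c(x,y) − f(x,y))·d(x):
-- a push of δ units along the residual arc (u,v) moves δ units of this
-- charge from the label d u to the smaller label d v.
module Submission where

open import Defs
open import Data.Bool using (true; false)
open import Data.Empty using (⊥-elim)
open import Data.Fin using (Fin; zero; suc; toℕ; _≟_)
open import Data.Fin.Properties using (any?; pigeonhole; suc-injective; toℕ≤pred[n])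
open import Data.Nat using (ℕ; zero; suc; _+_; _*_; _∸_; _≤_; _<_; _⊓_; z≤n; s≤s; _<?_; >-nonZero)
import Data.Nat as ℕ
open import Data.Nat.Induction using (<-wellFounded)
open import Data.Nat.Properties hiding (_≟_; suc-injective)
open import Algebra.Properties.CommutativeSemigroup +-commutativeSemigroup
  using (interchange; x∙yz≈y∙xz)
open import Data.Nat.Tactic.RingSolver using (solve-∀)
open import Data.Product using (_×_; _,_; ∃; proj₁; proj₂; swap)
open import Function using (_∘_; case_of_)
open import Induction.WellFounded using (Acc; acc)
open import Level using (0ℓ)
open import Relation.Binary.PropositionalEquality
open import Relation.Nullary using (¬_; Dec; yes; no; contradiction)
open import Relation.Nullary.Decidable using (_×-dec_)
open import Relation.Unary using (Pred; Decidable)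

sumFin-cong : ∀ {n} {g h : Fin n → ℕ} → (∀ i → g i ≡ h i) → sumFin g ≡ sumFin h
sumFin-cong {zero}  eq = refl
sumFin-cong {suc n} eq = cong₂ _+_ (eq zero) (sumFin-cong (eq ∘ suc))

sumFin-zero : ∀ {n} {g : Fin n → ℕ} → (∀ i → g i ≡ 0) → sumFin g ≡ 0
sumFin-zero {zero}  eq = refl
sumFin-zero {suc n} eq = cong₂ _+_ (eq zero) (sumFin-zero (eq ∘ suc))

sumFin-mono-≤ : ∀ {n} {g h : Fin n → ℕ} → (∀ i → g i ≤ h i) → sumFin g ≤ sumFin h
sumFin-mono-≤ {zero}  le = z≤n
sumFin-mono-≤ {suc n} le = +-mono-≤ (le zero) (sumFin-mono-≤ (le ∘ suc))

sumFin-mono-< : ∀ {n} {g h : Fin n → ℕ} → (∀ i → g i ≤ h i) →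
                ∀ k → g k < h k → sumFin g < sumFin h
sumFin-mono-< le zero    lt = +-mono-<-≤ lt (sumFin-mono-≤ (le ∘ suc))
sumFin-mono-< le (suc k) lt = +-mono-≤-< (le zero) (sumFin-mono-< (le ∘ suc) k lt)

sumFin-distrib-+ : ∀ {n} (g h : Fin n → ℕ) →
                   sumFin (λ i → g i + h i) ≡ sumFin g + sumFin h
sumFin-distrib-+ {zero}  g h = refl
sumFin-distrib-+ {suc n} g h =
  trans (cong (g zero + h zero +_) (sumFin-distrib-+ (g ∘ suc) (h ∘ suc)))
        (interchange (g zero) (h zero) (sumFin (g ∘ suc)) (sumFin (h ∘ suc)))

sumFin-comm : ∀ {m n} (h : Fin m → Fin n → ℕ) →
              sumFin (λ x → sumFin (h x)) ≡ sumFin (λ y → sumFin (λ x → h x y))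
sumFin-comm {zero} {n} h = sym (sumFin-zero {n} (λ _ → refl))
sumFin-comm {suc m}     h =
  trans (cong (sumFin (h zero) +_) (sumFin-comm (h ∘ suc)))
        (sym (sumFin-distrib-+ (h zero) (λ y → sumFin (λ x → h (suc x) y))))

sumFin-update : ∀ {n} {g g′ : Fin n → ℕ} b → (∀ i → i ≢ b → g′ i ≡ g i) →
                g b + sumFin g′ ≡ g′ b + sumFin g
sumFin-update {suc n} {g} {g′} zero agree
  rewrite sumFin-cong {g = g′ ∘ suc} {h = g ∘ suc} (λ i → agree (suc i) λ ())
  = x∙yz≈y∙xz (g zero) (g′ zero) (sumFin (g ∘ suc))
sumFin-update {suc n} {g} {g′} (suc b) agree = begin
  g (suc b) + (g′ zero + G′) ≡⟨ x∙yz≈y∙xz (g (suc b)) (g′ zero) G′ ⟩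
  g′ zero + (g (suc b) + G′) ≡⟨ cong₂ _+_ (agree zero λ ()) tail ⟩
  g zero + (g′ (suc b) + G)  ≡⟨ x∙yz≈y∙xz (g zero) (g′ (suc b)) G ⟩
  g′ (suc b) + (g zero + G)  ∎
  where
  open ≡-Reasoning
  G G′ : ℕ
  G = sumFin (g ∘ suc)
  G′ = sumFin (g′ ∘ suc)
  tail : g (suc b) + G′ ≡ g′ (suc b) + G
  tail = sumFin-update b (λ i i≢b → agree (suc i) (i≢b ∘ suc-injective))

keepIf : ∀ {p} {P : Set p} → Dec P → ℕ → ℕ
keepIf (yes _) k = k
keepIf (no _)  k = 0

keepIf-sumFin : ∀ {p n} {P : Set p} (P? : Dec P) (g : Fin n → ℕ) →
                keepIf P? (sumFin g) ≡ sumFin (λ i → keepIf P? (g i))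
keepIf-sumFin (yes _) g = refl
keepIf-sumFin {n = n} (no _) g = sym (sumFin-zero {n} (λ _ → refl))

keepIf-≤ : ∀ {p} {P : Set p} (P? : Dec P) k → keepIf P? k ≤ k
keepIf-≤ (yes _) k = ≤-refl
keepIf-≤ (no _)  k = z≤n

keepIf-mono-≤ : ∀ {p} {P : Set p} (P? : Dec P) {a b} → a ≤ b → keepIf P? a ≤ keepIf P? b
keepIf-mono-≤ (yes _) le = le
keepIf-mono-≤ (no _)  le = z≤n

-- Every unit entering a vertex of P along an arc f y x comes from a vertex y
-- of P, and so also counts as a unit leaving a vertex of P.
inflow≤outflow-of-closed-set :
  ∀ {n} {P : Pred (Fin n) 0ℓ} (P? : Decidable P) (f : Fin n → Fin n → ℕ) →
  (∀ x y → P x → ¬ P y → f y x ≡ 0) →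
  sumFin (λ x → keepIf (P? x) (sumFin (λ y → f y x))) ≤
  sumFin (λ x → keepIf (P? x) (sumFin (λ y → f x y)))
inflow≤outflow-of-closed-set P? f closed = begin
  sumFin (λ x → keepIf (P? x) (sumFin (λ y → f y x)))
    ≡⟨ sumFin-cong (λ x → keepIf-sumFin (P? x) (λ y → f y x)) ⟩
  sumFin (λ x → sumFin (λ y → keepIf (P? x) (f y x)))
    ≡⟨ sumFin-cong (λ x → sumFin-cong (λ y → inflow-from-P x y)) ⟩
  sumFin (λ x → sumFin (λ y → keepIf (P? y) (keepIf (P? x) (f y x))))
    ≡⟨ sumFin-comm (λ x y → keepIf (P? y) (keepIf (P? x) (f y x))) ⟩
  sumFin (λ y → sumFin (λ x → keepIf (P? y) (keepIf (P? x) (f y x))))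
    ≤⟨ sumFin-mono-≤ (λ y → sumFin-mono-≤ (λ x → keepIf-mono-≤ (P? y) (keepIf-≤ (P? x) _))) ⟩
  sumFin (λ y → sumFin (λ x → keepIf (P? y) (f y x)))
    ≡⟨ sumFin-cong (λ y → sym (keepIf-sumFin (P? y) (f y))) ⟩
  sumFin (λ y → keepIf (P? y) (sumFin (λ x → f y x))) ∎
  where
  open ≤-Reasoning
  inflow-from-P : ∀ x y → keepIf (P? x) (f y x) ≡ keepIf (P? y) (keepIf (P? x) (f y x))
  inflow-from-P x y with P? x | P? y
  ... | yes _    | yes _    = refl
  ... | yes x∈P | no y∉P  = closed x y x∈P y∉P
  ... | no _    | yes _    = refl
  ... | no _    | no _     = refl

arcPotential : (flow capacity dx dy : ℕ) → ℕ
arcPotential a c dx dy = a * dy + (c ∸ a) * dx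

arcPotential-shift : ∀ a δ c dx dy → a + δ ≤ c →
                     arcPotential (a + δ) c dx dy + δ * dx ≡ arcPotential a c dx dy + δ * dy
arcPotential-shift a δ c dx dy a+δ≤c with m≤n⇒∃[o]m+o≡n a+δ≤c
... | k , refl rewrite m+n∸m≡n (a + δ) k | +-assoc a δ k | m+n∸m≡n a (δ + k) =
  identity a δ k dx dy
  where
  identity : ∀ a δ k dx dy →
             (a + δ) * dy + k * dx + δ * dx ≡ a * dy + (δ + k) * dx + δ * dy
  identity = solve-∀

arcPotential-increase-< : ∀ {a δ c dx dy} → a + δ ≤ c → 0 < δ → dy < dx →
                          arcPotential (a + δ) c dx dy < arcPotential a c dx dy
arcPotential-increase-< {a} {δ} {c} {dx} {dy} a+δ≤c 0<δ dy<dx =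
  +-cancelʳ-< (δ * dx) _ _ (begin-strict
    arcPotential (a + δ) c dx dy + δ * dx ≡⟨ arcPotential-shift a δ c dx dy a+δ≤c ⟩
    arcPotential a c dx dy + δ * dy       <⟨ +-monoʳ-< _ (*-monoʳ-< δ {{>-nonZero 0<δ}} dy<dx) ⟩
    arcPotential a c dx dy + δ * dx       ∎)
  where open ≤-Reasoning

arcPotential-decrease-< : ∀ {a δ c dx dy} → δ ≤ a → a ≤ c → 0 < δ → dx < dy →
                          arcPotential (a ∸ δ) c dx dy < arcPotential a c dx dy
arcPotential-decrease-< {a} {δ} {c} {dx} {dy} δ≤a a≤c 0<δ dx<dy =
  +-cancelʳ-< (δ * dy) _ _ (begin-strict
    arcPotential (a ∸ δ) c dx dy + δ * dy
      ≡⟨ sym (arcPotential-shift (a ∸ δ) δ c dx dy a∸δ+δ≤c) ⟩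
    arcPotential (a ∸ δ + δ) c dx dy + δ * dx
      ≡⟨ cong (λ a′ → arcPotential a′ c dx dy + δ * dx) (m∸n+n≡m δ≤a) ⟩
    arcPotential a c dx dy + δ * dx
      <⟨ +-monoʳ-< _ (*-monoʳ-< δ {{>-nonZero 0<δ}} dx<dy) ⟩
    arcPotential a c dx dy + δ * dy ∎)
  where
  open ≤-Reasoning
  a∸δ+δ≤c : a ∸ δ + δ ≤ c
  a∸δ+δ≤c = subst (_≤ c) (sym (m∸n+n≡m δ≤a)) a≤c

module _ {n : ℕ} (N : Network n) where

  open Network N

  Flow : Set
  Flow = Fin n → Fin n → ℕ

  Labelling : Set
  Labelling = Fin n → ℕ

  Capacitated : Flow → Set
  Capacitated f = ∀ x y → f x y ≤ cap x y

  Preflow : Flow → Set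
  Preflow f = ∀ x → x ≢ s → outflow N f x ≤ inflow N f x

  Valid : Flow → Labelling → Set
  Valid f d = ∀ x y → 0 < residual N f x y → d x ≤ suc (d y)

  record Invariant (f : Flow) (d : Labelling) : Set where
    field
      capacitated : Capacitated f
      preflow     : Preflow f
      valid       : Valid f d
      label-s     : d s ≡ n

  no-self-loop : ∀ x → arc x x ≡ false
  no-self-loop x with arc x x in loop
  ... | true  = trans (sym loop) (antipar x x loop)
  ... | false = refl

  flow-off-arc : ∀ {f} → Capacitated f → ∀ {x y} → arc x y ≡ false → f x y ≡ 0
  flow-off-arc {f} f≤c {x} {y} off = n≤0⇒n≡0 (subst (f x y ≤_) (cap-off x y off) (f≤c x y))

  residual-cong : ∀ {f f′} x y → f′ x y ≡ f x y → f′ y x ≡ f y x →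
                  residual N f′ x y ≡ residual N f x y
  residual-cong x y eq eq′ rewrite eq | eq′ = refl

  residual-saturated : ∀ {f u v} → f u v ≡ cap u v → f v u ≡ 0 → residual N f u v ≡ 0
  residual-saturated {f} {u} {v} full empty with arc u v
  ... | true = trans (cong (cap u v ∸_) full) (n∸n≡0 (cap u v))
  ... | false with arc v u
  ... | true  = empty
  ... | false = refl

  residual≡0⇒reverse≡0 : ∀ {f} → Capacitated f → ∀ x y → residual N f x y ≡ 0 → f y x ≡ 0
  residual≡0⇒reverse≡0 f≤c x y r≡0 with arc x y in xy
  ... | true = flow-off-arc f≤c (antipar x y xy)
  ... | false with arc y x in yx
  ... | true  = r≡0
  ... | false = flow-off-arc f≤c yx

  closed-set-has-no-excess :
    ∀ {f} → Capacitated f → Preflow f →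
    {P : Pred (Fin n) 0ℓ} (P? : Decidable P) → ¬ P s →
    (∀ x y → P x → ¬ P y → residual N f x y ≡ 0) →
    ∀ {u} → P u → ¬ (outflow N f u < inflow N f u)
  closed-set-has-no-excess {f} f≤c pre {P} P? s∉P closed {u} u∈P out<in =
    <⇒≱ (sumFin-mono-< out≤in u out<in-at-u)
        (inflow≤outflow-of-closed-set P? f
          (λ x y x∈P y∉P → residual≡0⇒reverse≡0 f≤c x y (closed x y x∈P y∉P)))
    where
    out≤in : ∀ x → keepIf (P? x) (outflow N f x) ≤ keepIf (P? x) (inflow N f x)
    out≤in x with P? x
    ... | yes x∈P = pre x (λ x≡s → s∉P (subst P x≡s x∈P))
    ... | no _    = z≤n
    out<in-at-u : keepIf (P? u) (outflow N f u) < keepIf (P? u) (inflow N f u)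
    out<in-at-u with P? u
    ... | yes _   = out<in
    ... | no u∉P = contradiction u∈P u∉P

  no-excess-above-empty-level :
    ∀ {f d} → Invariant f d → ∀ g → n < g → (∀ x → d x ≢ g) →
    ∀ {u} → g < d u → ¬ (outflow N f u < inflow N f u)
  no-excess-above-empty-level {f} {d} I g n<g empty =
    closed-set-has-no-excess capacitated preflow (λ x → g <? d x) s-below closed
    where
    open Invariant I
    s-below : ¬ (g < d s)
    s-below g<ds = <-asym n<g (subst (g <_) label-s g<ds)
    closed : ∀ x y → g < d x → ¬ (g < d y) → residual N f x y ≡ 0
    closed x y g<dx g≮dy = n≤0⇒n≡0 (≮⇒≥ λ r>0 →
      empty y (≤-antisym (≮⇒≥ g≮dy) (≤-pred (≤-trans g<dx (valid x y r>0)))))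

  active-label-< : ∀ {f d} → Invariant f d → ∀ {u} → u ≢ s →
                   outflow N f u < inflow N f u → d u < n + n
  active-label-< {d = d} I {u} u≢s active = ≰⇒> no-room
    where
    open Invariant I
    occupied : ∀ ℓ → n ≤ ℓ → ℓ ≤ d u → ∃ λ x → d x ≡ ℓ
    occupied ℓ n≤ℓ ℓ≤du with any? (λ x → d x ℕ.≟ ℓ)
    ... | yes found = found
    ... | no none   = contradiction active
      (no-excess-above-empty-level I ℓ n<ℓ (λ x dx≡ℓ → none (x , dx≡ℓ)) ℓ<du)
      where
      n<ℓ : n < ℓ
      n<ℓ = ≤∧≢⇒< n≤ℓ (λ n≡ℓ → none (s , trans label-s n≡ℓ))
      ℓ<du : ℓ < d u
      ℓ<du = ≤∧≢⇒< ℓ≤du (λ ℓ≡du → none (u , sym ℓ≡du))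
    level : n + n ≤ d u → (i : Fin (suc n)) → ∃ λ x → d x ≡ n + toℕ i
    level 2n≤du i = occupied _ (m≤m+n n (toℕ i)) (≤-trans (+-monoʳ-≤ n (toℕ≤pred[n] i)) 2n≤du)
    no-room : ¬ (n + n ≤ d u)
    no-room 2n≤du with pigeonhole (n<1+n n) (proj₁ ∘ level 2n≤du)
    ... | i , j , i<j , same = <-irrefl (+-cancelˡ-≡ n _ _ (begin
      n + toℕ i              ≡⟨ sym (proj₂ (level 2n≤du i)) ⟩
      d (proj₁ (level _ i))  ≡⟨ cong d same ⟩
      d (proj₁ (level _ j))  ≡⟨ proj₂ (level 2n≤du j) ⟩
      n + toℕ j              ∎)) i<j
      where open ≡-Reasoning

  setFlow-elim : ∀ (P : Fin n → Fin n → ℕ → Set) f a b k →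
                 P a b k → (∀ x y → P x y (f x y)) → ∀ x y → P x y (setFlow N f a b k x y)
  setFlow-elim P f a b k new old x y with x ≟ a | y ≟ b
  ... | yes refl | yes refl = new
  ... | yes _    | no _     = old x y
  ... | no _     | _        = old x y

  setFlow-hit : ∀ f a b k → setFlow N f a b k a b ≡ k
  setFlow-hit f a b k with a ≟ a | b ≟ b
  ... | yes _   | yes _   = refl
  ... | yes _   | no b≢b = contradiction refl b≢b
  ... | no a≢a | _       = contradiction refl a≢a

  setFlow-miss : ∀ f a b k x y → ¬ (x ≡ a × y ≡ b) → setFlow N f a b k x y ≡ f x y
  setFlow-miss f a b k = setFlow-elim (λ x y m → ¬ (x ≡ a × y ≡ b) → m ≡ f x y) f a b k
    (λ ne → contradiction (refl , refl) ne) (λ _ _ _ → refl)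

  outflow-setFlow : ∀ f a b k → f a b + outflow N (setFlow N f a b k) a ≡ k + outflow N f a
  outflow-setFlow f a b k =
    trans (sumFin-update b (λ y y≢b → setFlow-miss f a b k a y (y≢b ∘ proj₂)))
          (cong (_+ outflow N f a) (setFlow-hit f a b k))

  inflow-setFlow : ∀ f a b k → f a b + inflow N (setFlow N f a b k) b ≡ k + inflow N f b
  inflow-setFlow f a b k =
    trans (sumFin-update a (λ x x≢a → setFlow-miss f a b k x b (x≢a ∘ proj₁)))
          (cong (_+ inflow N f b) (setFlow-hit f a b k))

  outflow-setFlow-other : ∀ f a b k {x} → x ≢ a → outflow N (setFlow N f a b k) x ≡ outflow N f x
  outflow-setFlow-other f a b k x≢a = sumFin-cong (λ y → setFlow-miss f a b k _ y (x≢a ∘ proj₁))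

  inflow-setFlow-other : ∀ f a b k {y} → y ≢ b → inflow N (setFlow N f a b k) y ≡ inflow N f y
  inflow-setFlow-other f a b k y≢b = sumFin-cong (λ x → setFlow-miss f a b k x _ (y≢b ∘ proj₂))

  capacitated-setFlow : ∀ {f} a b {k} → Capacitated f → k ≤ cap a b → Capacitated (setFlow N f a b k)
  capacitated-setFlow {f} a b {k} f≤c k≤c = setFlow-elim (λ x y m → m ≤ cap x y) f a b k k≤c f≤c

  setFlow-≥ : ∀ f a b {k} → f a b ≤ k → ∀ x y → f x y ≤ setFlow N f a b k x y
  setFlow-≥ f a b {k} le = setFlow-elim (λ x y m → f x y ≤ m) f a b k le (λ _ _ → ≤-refl)

  setFlow-≤ : ∀ f a b {k} → k ≤ f a b → ∀ x y → setFlow N f a b k x y ≤ f x y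
  setFlow-≤ f a b {k} le = setFlow-elim (λ x y m → m ≤ f x y) f a b k le (λ _ _ → ≤-refl)

  preflow-augment : ∀ {f u v δ} → Preflow f → u ≢ s → u ≢ v → δ ≤ excess N f u →
                    Preflow (setFlow N f u v (f u v + δ))
  preflow-augment {f} {u} {v} {δ} pre u≢s u≢v δ≤e x x≢s = case x ≟ u of λ where
      (yes refl) → at-u
      (no x≢u)   → elsewhere x≢u
    where
    open ≤-Reasoning
    f′ : Flow
    f′ = setFlow N f u v (f u v + δ)
    outflow-grows : f u v + outflow N f′ u ≡ f u v + (δ + outflow N f u)
    outflow-grows = trans (outflow-setFlow f u v _) (+-assoc (f u v) δ _)
    at-u : outflow N f′ u ≤ inflow N f′ u
    at-u = begin
      outflow N f′ u     ≡⟨ +-cancelˡ-≡ (f u v) _ _ outflow-grows ⟩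
      δ + outflow N f u  ≤⟨ m≤o∸n⇒m+n≤o δ (pre u u≢s) δ≤e ⟩
      inflow N f u       ≡⟨ sym (inflow-setFlow-other f u v _ u≢v) ⟩
      inflow N f′ u      ∎
    elsewhere : x ≢ u → outflow N f′ x ≤ inflow N f′ x
    elsewhere x≢u = begin
      outflow N f′ x     ≡⟨ outflow-setFlow-other f u v _ x≢u ⟩
      outflow N f x      ≤⟨ pre x x≢s ⟩
      inflow N f x       ≤⟨ sumFin-mono-≤ (λ y → setFlow-≥ f u v (m≤m+n _ δ) y x) ⟩
      inflow N f′ x      ∎

  preflow-cancel : ∀ {f u v δ} → Preflow f → u ≢ s → u ≢ v → δ ≤ f v u → δ ≤ excess N f u →
                   Preflow (setFlow N f v u (f v u ∸ δ))
  preflow-cancel {f} {u} {v} {δ} pre u≢s u≢v δ≤f δ≤e x x≢s = case x ≟ u of λ where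
      (yes refl) → at-u
      (no x≢u)   → elsewhere x≢u
    where
    open ≤-Reasoning
    f′ : Flow
    f′ = setFlow N f v u (f v u ∸ δ)
    inflow-drops : δ + inflow N f′ u ≡ inflow N f u
    inflow-drops = +-cancelˡ-≡ (f v u ∸ δ) _ _ (begin-equality
      f v u ∸ δ + (δ + inflow N f′ u) ≡⟨ sym (+-assoc (f v u ∸ δ) δ _) ⟩
      f v u ∸ δ + δ + inflow N f′ u   ≡⟨ cong (_+ inflow N f′ u) (m∸n+n≡m δ≤f) ⟩
      f v u + inflow N f′ u           ≡⟨ inflow-setFlow f v u _ ⟩
      f v u ∸ δ + inflow N f u        ∎)
    at-u : outflow N f′ u ≤ inflow N f′ u
    at-u = +-cancelˡ-≤ δ _ _ (begin
      δ + outflow N f′ u ≡⟨ cong (δ +_) (outflow-setFlow-other f v u _ u≢v) ⟩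
      δ + outflow N f u  ≤⟨ m≤o∸n⇒m+n≤o δ (pre u u≢s) δ≤e ⟩
      inflow N f u       ≡⟨ sym inflow-drops ⟩
      δ + inflow N f′ u  ∎)
    elsewhere : x ≢ u → outflow N f′ x ≤ inflow N f′ x
    elsewhere x≢u = begin
      outflow N f′ x     ≤⟨ sumFin-mono-≤ (setFlow-≤ f v u (m∸n≤m _ δ) x) ⟩
      outflow N f x      ≤⟨ pre x x≢s ⟩
      inflow N f x       ≡⟨ sym (inflow-setFlow-other f v u _ x≢u) ⟩
      inflow N f′ x      ∎

  valid-push : ∀ {f f′ d u v} → Valid f d → 0 < residual N f u v → d v < d u →
               (∀ x y → ¬ (x ≡ u × y ≡ v) → ¬ (x ≡ v × y ≡ u) → f′ x y ≡ f x y) →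
               Valid f′ d
  valid-push {f} {f′} {u = u} {v} valid r dv<du agree x y r′ with (x ≟ u) ×-dec (y ≟ v)
  ... | yes (refl , refl) = valid u v r
  ... | no ≢uv with (x ≟ v) ×-dec (y ≟ u)
  ...   | yes (refl , refl) = m≤n⇒m≤1+n (<⇒≤ dv<du)
  ...   | no ≢vu = valid x y (subst (0 <_) same-residual r′)
    where
    same-residual : residual N f′ x y ≡ residual N f x y
    same-residual = residual-cong {f} {f′} x y (agree x y ≢uv ≢vu)
                                               (agree y x (≢vu ∘ swap) (≢uv ∘ swap))

  potential : Flow → Labelling → ℕ
  potential f d = sumFin λ x → sumFin λ y → arcPotential (f x y) (cap x y) (d x) (d y)

  potential-setFlow-< :
    ∀ f d a b k →
    arcPotential k (cap a b) (d a) (d b) < arcPotential (f a b) (cap a b) (d a) (d b) →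
    potential (setFlow N f a b k) d < potential f d
  potential-setFlow-< f d a b k lt =
    sumFin-mono-< (λ x → sumFin-mono-≤ (pointwise x)) a (sumFin-mono-< (pointwise a) b lt-at-ab)
    where
    Below : Fin n → Fin n → ℕ → Set
    Below x y m = arcPotential m (cap x y) (d x) (d y) ≤ arcPotential (f x y) (cap x y) (d x) (d y)
    pointwise : ∀ x y → Below x y (setFlow N f a b k x y)
    pointwise = setFlow-elim Below f a b k (<⇒≤ lt) (λ _ _ → ≤-refl)
    lt-at-ab : arcPotential (setFlow N f a b k a b) (cap a b) (d a) (d b)
             < arcPotential (f a b) (cap a b) (d a) (d b)
    lt-at-ab rewrite setFlow-hit f a b k = lt

  push-along-arc :
    ∀ {f d u v δ} → Invariant f d → u ≢ s → 0 < residual N f u v → d v < d u →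
    0 < δ → δ ≤ excess N f u → δ ≤ cap u v ∸ f u v →
    let f′ = setFlow N f u v (f u v + δ) in Invariant f′ d × potential f′ d < potential f d
  push-along-arc {f} {d} {u} {v} {δ} I u≢s r dv<du 0<δ δ≤e δ≤r =
    record { capacitated = capacitated-setFlow u v capacitated fits
           ; preflow     = preflow-augment preflow u≢s (λ { refl → <-irrefl refl dv<du }) δ≤e
           ; valid       = valid-push valid r dv<du (λ x y ≢uv _ → setFlow-miss f u v _ x y ≢uv)
           ; label-s     = label-s }
    , potential-setFlow-< f d u v _ (arcPotential-increase-< fits 0<δ dv<du)
    where
    open Invariant I
    fits : f u v + δ ≤ cap u v
    fits = ≤-trans (+-monoʳ-≤ (f u v) δ≤r) (≤-reflexive (m+[n∸m]≡n (capacitated u v)))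

  push-against-arc :
    ∀ {f d u v δ} → Invariant f d → u ≢ s → 0 < residual N f u v → d v < d u →
    0 < δ → δ ≤ excess N f u → δ ≤ f v u →
    let f′ = setFlow N f v u (f v u ∸ δ) in Invariant f′ d × potential f′ d < potential f d
  push-against-arc {f} {d} {u} {v} {δ} I u≢s r dv<du 0<δ δ≤e δ≤f =
    record { capacitated = capacitated-setFlow v u capacitated (≤-trans (m∸n≤m _ δ) (capacitated v u))
           ; preflow     = preflow-cancel preflow u≢s (λ { refl → <-irrefl refl dv<du }) δ≤f δ≤e
           ; valid       = valid-push valid r dv<du (λ x y _ ≢vu → setFlow-miss f v u _ x y ≢vu)
           ; label-s     = label-s }
    , potential-setFlow-< f d v u _ (arcPotential-decrease-< δ≤f (capacitated v u) 0<δ dv<du)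
    where open Invariant I

  push-step :
    ∀ {f d u v} → Invariant f d → Active N f u → 0 < residual N f u v → d v < d u →
    let f′ = pushFlow N f u v (excess N f u ⊓ residual N f u v)
    in Invariant f′ d × potential f′ d < potential f d
  push-step {f} {d} {u} {v} I (u≢s , _ , out<in) r dv<du with arc u v in uv
  ... | true =
    push-along-arc I u≢s r′ dv<du (⊓-pres-m< (m<n⇒0<n∸m out<in) r) (m⊓n≤m _ _) (m⊓n≤n _ _)
    where
    r′ : 0 < residual N f u v
    r′ rewrite uv = r
  ... | false with arc v u in vu
  ...   | true =
    push-against-arc I u≢s r′ dv<du (⊓-pres-m< (m<n⇒0<n∸m out<in) r) (m⊓n≤m _ _) (m⊓n≤n _ _)
    where
    r′ : 0 < residual N f u v
    r′ rewrite uv | vu = r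
  ...   | false = ⊥-elim (<-irrefl refl r)

  setLabel-hit : ∀ d a k → setLabel N d a k a ≡ k
  setLabel-hit d a k with a ≟ a
  ... | yes _   = refl
  ... | no a≢a = contradiction refl a≢a

  setLabel-miss : ∀ d a k {x} → x ≢ a → setLabel N d a k x ≡ d x
  setLabel-miss d a k {x} x≢a with x ≟ a
  ... | yes x≡a = contradiction x≡a x≢a
  ... | no _    = refl

  valid-raise : ∀ {f d u k} → Valid f d → d u ≤ k →
                (∀ y → 0 < residual N f u y → k ≤ suc (d y)) → Valid f (setLabel N d u k)
  valid-raise {u = u} {k} valid du≤k k≤ x y r with x ≟ u | y ≟ u
  ... | yes refl | yes refl = n≤1+n k
  ... | yes refl | no _     = k≤ y r
  ... | no _     | yes refl = ≤-trans (valid x u r) (s≤s du≤k)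
  ... | no _     | no _     = valid x y r

  labelSlack : Labelling → ℕ
  labelSlack d = sumFin λ x → (n + n) ∸ d x

  labelSlack-raise : ∀ d u k → d u < k → k ≤ n + n → labelSlack (setLabel N d u k) < labelSlack d
  labelSlack-raise d u k du<k k≤2n = sumFin-mono-< pointwise u at-u
    where
    pointwise : ∀ x → (n + n) ∸ setLabel N d u k x ≤ (n + n) ∸ d x
    pointwise x with x ≟ u
    ... | yes refl = ∸-monoʳ-≤ (n + n) (<⇒≤ du<k)
    ... | no _     = ≤-refl
    at-u : (n + n) ∸ setLabel N d u k u < (n + n) ∸ d u
    at-u rewrite setLabel-hit d u k = ∸-monoʳ-< du<k k≤2n

  relabel-step :
    ∀ {f d u m} → Invariant f d → Active N f u →
    (∀ v → 0 < residual N f u v → ¬ (d v < d u)) →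
    (∃ λ v → 0 < residual N f u v × d v ≡ m) →
    (∀ v → 0 < residual N f u v → m ≤ d v) →
    let d′ = setLabel N d u (suc m) in Invariant f d′ × labelSlack d′ < labelSlack d
  relabel-step {f} {d} {u} {m} I (u≢s , _ , out<in) no-admissible (w , rw , dw≡m) m≤ =
    I′ , labelSlack-raise d u (suc m) (s≤s du≤m) (<⇒≤ bound)
    where
    open Invariant I
    du≤m : d u ≤ m
    du≤m = subst (d u ≤_) dw≡m (≮⇒≥ (no-admissible w rw))
    I′ : Invariant f (setLabel N d u (suc m))
    I′ = record { capacitated = capacitated
                ; preflow     = preflow
                ; valid       = valid-raise valid (m≤n⇒m≤1+n du≤m) (λ y r → s≤s (m≤ y r))
                ; label-s     = trans (setLabel-miss d u (suc m) (u≢s ∘ sym)) label-s }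
    bound : suc m < n + n
    bound = subst (_< n + n) (setLabel-hit d u (suc m)) (active-label-< I′ u≢s out<in)

  initFlow : Flow
  initFlow = State.flow (initState N)

  initLabel : Labelling
  initLabel = State.label (initState N)

  initFlow-from-s : ∀ y → initFlow s y ≡ cap s y
  initFlow-from-s y with s ≟ s | arc s y in sy
  ... | yes _   | true  = refl
  ... | yes _   | false = sym (cap-off s y sy)
  ... | no s≢s | _     = contradiction refl s≢s

  initFlow-elsewhere : ∀ {x} y → x ≢ s → initFlow x y ≡ 0
  initFlow-elsewhere {x} y x≢s with x ≟ s
  ... | yes x≡s = contradiction x≡s x≢s
  ... | no _    = refl

  initFlow-into-s : ∀ y → initFlow y s ≡ 0
  initFlow-into-s y = case y ≟ s of λ where
    (yes refl) → trans (initFlow-from-s s) (cap-off s s (no-self-loop s))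
    (no y≢s)   → initFlow-elsewhere s y≢s

  initResidual-from-s : ∀ y → residual N initFlow s y ≡ 0
  initResidual-from-s y = residual-saturated {initFlow} (initFlow-from-s y) (initFlow-into-s y)

  initLabel-s : initLabel s ≡ n
  initLabel-s with s ≟ s
  ... | yes _   = refl
  ... | no s≢s = contradiction refl s≢s

  initLabel-elsewhere : ∀ {x} → x ≢ s → initLabel x ≡ 0
  initLabel-elsewhere {x} x≢s with x ≟ s
  ... | yes x≡s = contradiction x≡s x≢s
  ... | no _    = refl

  initial-invariant : Invariant initFlow initLabel
  initial-invariant = record
    { capacitated = capacitated₀ ; preflow = preflow₀ ; valid = valid₀ ; label-s = initLabel-s }
    where
    capacitated₀ : Capacitated initFlow
    capacitated₀ x y = case x ≟ s of λ where
      (yes refl) → ≤-reflexive (initFlow-from-s y)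
      (no x≢s)   → subst (_≤ cap x y) (sym (initFlow-elsewhere y x≢s)) z≤n
    preflow₀ : Preflow initFlow
    preflow₀ x x≢s =
      subst (_≤ inflow N initFlow x) (sym (sumFin-zero (λ y → initFlow-elsewhere y x≢s))) z≤n
    valid₀ : Valid initFlow initLabel
    valid₀ x y r = case x ≟ s of λ where
      (yes refl) → ⊥-elim (<-irrefl (sym (initResidual-from-s y)) r)
      (no x≢s)   → subst (_≤ suc (initLabel y)) (sym (initLabel-elsewhere x≢s)) z≤n

  terminates : ∀ {f d} → Acc _<_ (labelSlack d) → Acc _<_ (potential f d) → Invariant f d →
               Acc (λ σ′ σ → Step N σ σ′) ⟨ f , d ⟩
  terminates {d = d} (acc lower-slack) = pushing
    where
    pushing : ∀ {f} → Acc _<_ (potential f d) → Invariant f d →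
              Acc (λ σ′ σ → Step N σ σ′) ⟨ f , d ⟩
    pushing (acc lower-potential) I = acc λ where
      (push u v active r dv<du) →
        let I′ , potential< = push-step I active r dv<du
        in pushing (lower-potential potential<) I′
      (relabel u m active no-admissible min-attained min-≤) →
        let I′ , slack< = relabel-step I active no-admissible min-attained min-≤
        in terminates (lower-slack slack<) (<-wellFounded _) I′

lemma5p1 : ∀ {n : ℕ} (N : Network n) → Acc (λ σ′ σ → Step N σ σ′) (initState N)
lemma5p1 N = terminates N (<-wellFounded _) (<-wellFounded _) (initial-invariant N)
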